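{- Let $G$ (with $n$ vertices), $v_0$, $u_{\max}\ne v_0$, $L(G)=\{E_1,\dots,E_\ell\}$ and the large sets $G_0,\dots,G_\ell$ be as in the context. For every $0\le i\le\ell$, $|V(G_i)|\ge n\big(1-\frac{i}{2\log n}\big)$.
   Context: Graphs are finite, simple, undirected, connected; $d$ is shortest-path distance; $\log$ is the natural logarithm. A graph is median if for every triple of distinct vertices $x,y,z$, $I(x,y)\cap I(y,z)\cap I(z,x)$ is a single vertex, where $I(u,v)=\{x:d(u,x)+d(x,v)=d(u,v)\}$. $\Theta$-classes: edges $uv,xy$ are $\Theta_0$-related if $uvyx$ is a 4-cycle with $uv,xy$ opposite; $\Theta$ is the reflexive-transitive closure; removing a $\Theta$-class from a median graph leaves two components, its halfspaces. Setting: $(G,\omega)$ is a weighted median graph ($\omega:V\to\mathbb{N}$, $d_\omega(u,v)=d(u,v)+\omega(v)$) with $n=|V(G)|\ge3$ such that every $\Theta$-class $E_j$ has a halfspace $H_j'$ (minority) of size $<n/(2\log n)$, the other being $H_j''$ (majority). $v_0$ is the unique vertex in every majority halfspace; $u_{\max}$ is a vertex maximizing $d_\omega(v_0,\cdot)$, chosen equal to $v_0$ when $v_0$ is a maximizer; assume $u_{\max}\neq v_0$. $L(G)$ is the set of $\Theta$-classes having an edge incident to $v_0$ and separating $v_0$ from $u_{\max}$, indexed $E_1,\dots,E_\ell$. Large sets: $G_0=G$, and $G_{i+1}$ is the subgraph of $G$ induced by $V(G_i)\cap H_{i+1}''$, $0\le i\le\ell-1$. -}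

module Defs where

open import Data.Nat using (ℕ; zero; suc; _+_; _*_; _^_; _≤_; _<_; _!)
open import Data.Fin using (Fin)
open import Data.Fin.Subset using (Subset; _∈_; ∣_∣)
open import Data.Product using (Σ; ∃; ∃-syntax; _×_; _,_; proj₁; proj₂; swap)
open import Data.Sum using (_⊎_)
open import Relation.Nullary using (¬_)
open import Relation.Binary.PropositionalEquality using (_≡_; _≢_)
open import Relation.Binary.Construct.Closure.ReflexiveTransitive using (Star)

-- Exponential comparisons (no reals in agda-stdlib).
-- expNum b K / K!  is the K-th partial sum  Σ_{k≤K} b^k / k!  of e^b.

expNum : ℕ → ℕ → ℕ
expNum b zero    = 1
expNum b (suc K) = suc K * expNum b K + b ^ suc K

-- m < e^b   (partial sums increase strictly to e^b)
_<exp_ : ℕ → ℕ → Set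
m <exp b = ∃[ K ] (m * K ! < expNum b K)

-- m ≤ e^b   iff  for every j, m < e^b + 1/(j+1)
_≤exp_ : ℕ → ℕ → Set
m ≤exp b = ∀ (j : ℕ) → ∃[ K ] (m * K ! * suc j < expNum b K * suc j + K !)

record Graph (n : ℕ) : Set₁ where
  field
    Adj    : Fin n → Fin n → Set
    sym    : ∀ {u v} → Adj u v → Adj v u
    irrefl : ∀ {u} → ¬ Adj u u

module _ {n : ℕ} (G : Graph n) where
  open Graph G

  data Walk : Fin n → Fin n → ℕ → Set where
    nil  : ∀ {u} → Walk u u 0
    cons : ∀ {u w v k} → Adj u w → Walk w v k → Walk u v (suc k)

  Connected : Set
  Connected = ∀ u v → ∃[ k ] Walk u v k

  Dist : Fin n → Fin n → ℕ → Set
  Dist u v k = Walk u v k × (∀ m → Walk u v m → k ≤ m)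

  InInterval : Fin n → Fin n → Fin n → Set
  InInterval u v x = ∀ a b c → Dist u x a → Dist x v b → Dist u v c → a + b ≡ c

  Median : Set
  Median = ∀ x y z → x ≢ y → y ≢ z → x ≢ z →
    ∃[ m ] ((InInterval x y m × InInterval y z m × InInterval z x m) ×
            (∀ m' → InInterval x y m' → InInterval y z m' → InInterval z x m' → m' ≡ m))

  Θ₀ : Fin n × Fin n → Fin n × Fin n → Set
  Θ₀ (u , v) (x , y) = Adj u v × Adj x y × Adj u x × Adj v y × u ≢ y × v ≢ x

  ΘStep : Fin n × Fin n → Fin n × Fin n → Set
  ΘStep e f = Θ₀ e f ⊎ (Adj (proj₁ e) (proj₂ e) × f ≡ swap e)

  -- Θ: reflexive-transitive closure (orientation-insensitive on edges)
  Θ : Fin n × Fin n → Fin n × Fin n → Set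
  Θ = Star ΘStep

  data Reach (e : Fin n × Fin n) (x : Fin n) : Fin n → Set where
    here : Reach e x x
    step : ∀ {y z} → Reach e x y → Adj y z → ¬ Θ (y , z) e → Reach e x z

  Halfspace : Fin n × Fin n → Fin n → Fin n → Set
  Halfspace e x = Reach e x

Card : {n : ℕ} → (Fin n → Set) → ℕ → Set
Card {n} P k = Σ (Subset n) λ s → ∣ s ∣ ≡ k × (∀ v → (v ∈ s → P v) × (P v → v ∈ s))

-- k < n / (2 log n)   ⇔   n^(2k) < e^n
SmallForN : ℕ → ℕ → Set
SmallForN n k = (n ^ (2 * k)) <exp n

module _ {n : ℕ} (G : Graph n) where

  IsMinority : Fin n × Fin n → Fin n → Set
  IsMinority e x = ∃[ k ] (Card (Halfspace G e x) k × SmallForN n k)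

  Majority : Fin n × Fin n → Fin n → Set
  Majority e v =
    (IsMinority e (proj₂ e) × Halfspace G e (proj₁ e) v) ⊎
    (IsMinority e (proj₁ e) × Halfspace G e (proj₂ e) v)

-- For an edge uv of a median graph every vertex lies in W_uv = {x | d(x,u) < d(x,v)} or in
-- W_vu. By uniqueness of medians, opposite edges of a square cross the cut (W_uv, W_vu) alike,
-- so the whole Θ-class of uv crosses it, and a geodesic from x ∈ W_uv to u stays in W_uv: the
-- halfspaces of u and v cover the graph. Hence every vertex outside the minority halfspaces
-- H′_1, …, H′_i lies in G_i, and n − |V(G_i)| ≤ Σ_j |H′_j| where n^(2|H′_j|) < e^n. Multiplying
-- these bounds uses e^a e^b ≤ e^(a+b) for partial sums of the exponential series, that is, the
-- Cauchy product formula, which rests on the binomial theorem.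

module Submission where

open import Defs
open import Data.Nat using (ℕ; zero; suc; _+_; _*_; _^_; _∸_; _≤_; _<_; _≤′_; ≤′-refl; ≤′-step;
  z≤n; s≤s; z<s; _≤?_; _!; NonZero; >-nonZero; +-*-rawSemiring; +-0-rawMonoid)
open import Data.Nat.Properties
open import Data.Nat.DivMod using (_/_; m/n*n≡m; n/n≡1; *-/-assoc)
open import Data.Nat.Divisibility using (m≤n⇒m!∣n!)
open import Data.Nat.Combinatorics using (_C_; nCk≡n!/k![n-k]!; k![n∸k]!∣n!)
open import Data.Nat.Induction using (<-rec)
open import Data.Nat.Solver using (module +-*-Solver)
open import Data.Fin using (Fin; toℕ; fromℕ<) renaming (_≟_ to _≟ᶠ_)
open import Data.Fin.Properties using (sequence; toℕ-fromℕ<; toℕ-injective)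
open import Data.Fin.Subset using (Subset; inside; outside; ∁; _∪_; _∉_; _⊆_; ∣_∣) renaming (⊥ to ∅)
open import Data.Fin.Subset.Properties
  using (_∈?_; x∈p∪q⁺; x∈∁p⇒x∉p; ∣⊥∣≡0; ∣∁p∣≡n∸∣p∣; p⊆q⇒∣p∣≤∣q∣; ∪-identityʳ)
open import Data.Vec using ([]; _∷_)
open import Data.Product using (Σ; ∃; ∃-syntax; _×_; _,_; proj₁; proj₂)
import Data.Product as Prod
open import Data.Sum using (_⊎_; inj₁; inj₂)
import Data.Sum as Sum
open import Data.Empty using (⊥; ⊥-elim)
open import Effect.Monad using (RawMonad)
open import Function using (_∘_)
open import Level using (0ℓ)
open import Relation.Nullary using (¬_; yes; no; contradiction)
open import Relation.Nullary.Negation using (¬¬-Monad; ¬¬-map)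
open import Relation.Nullary.Decidable using (¬¬-excluded-middle; decidable-stable)
open import Relation.Binary.PropositionalEquality
  using (_≡_; _≢_; refl; sym; trans; cong; cong₂; subst; subst₂; module ≡-Reasoning)
open import Relation.Binary.Construct.Closure.ReflexiveTransitive using (ε; _◅_; _◅◅_)
open import Algebra.Properties.CommutativeSemigroup +-commutativeSemigroup
  using () renaming (interchange to +-interchange)
import Algebra.Properties.CommutativeSemiring.Binomial +-*-commutativeSemiring as Binomial
open import Algebra.Definitions.RawSemiring +-*-rawSemiring using () renaming (_^_ to _^ᴿ_; _×_ to _×ᴿ_)
open import Algebra.Definitions.RawMonoid +-0-rawMonoid using () renaming (sum to sumᶠ)

open +-*-Solver using (solve; _:*_; _:=_)

∑< : ℕ → (ℕ → ℕ) → ℕ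
∑< zero    f = 0
∑< (suc N) f = ∑< N f + f N

infix 6.5 ∑<
syntax ∑< N (λ i → e) = ∑[ i < N ] e

∑<-cong : ∀ N {f g : ℕ → ℕ} → (∀ {i} → i < N → f i ≡ g i) → ∑< N f ≡ ∑< N g
∑<-cong zero    f≡g = refl
∑<-cong (suc N) f≡g = cong₂ _+_ (∑<-cong N (f≡g ∘ m<n⇒m<1+n)) (f≡g (n<1+n N))

∑<-mono-≤ : ∀ N {f g : ℕ → ℕ} → (∀ {i} → i < N → f i ≤ g i) → ∑< N f ≤ ∑< N g
∑<-mono-≤ zero    f≤g = ≤-refl
∑<-mono-≤ (suc N) f≤g = +-mono-≤ (∑<-mono-≤ N (f≤g ∘ m<n⇒m<1+n)) (f≤g (n<1+n N))

∑<-monoˡ-≤ : ∀ (f : ℕ → ℕ) {M N} → M ≤′ N → ∑< M f ≤ ∑< N f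
∑<-monoˡ-≤ f ≤′-refl        = ≤-refl
∑<-monoˡ-≤ f (≤′-step M≤′N) = ≤-trans (∑<-monoˡ-≤ f M≤′N) (m≤m+n _ _)

∑<-distribˡ-* : ∀ N c (f : ℕ → ℕ) → c * ∑< N f ≡ ∑[ i < N ] c * f i
∑<-distribˡ-* zero    c f = *-zeroʳ c
∑<-distribˡ-* (suc N) c f =
  trans (*-distribˡ-+ c (∑< N f) (f N)) (cong (_+ c * f N) (∑<-distribˡ-* N c f))

∑<-distrib-+ : ∀ N (f g : ℕ → ℕ) → ∑[ i < N ] (f i + g i) ≡ ∑< N f + ∑< N g
∑<-distrib-+ zero    f g = refl
∑<-distrib-+ (suc N) f g =
  trans (cong (_+ (f N + g N)) (∑<-distrib-+ N f g)) (+-interchange (∑< N f) (∑< N g) (f N) (g N))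

∑<-∑<-distribˡ-* : ∀ M N c (f : ℕ → ℕ → ℕ) →
  c * (∑[ p < M ] ∑[ q < N ] f p q) ≡ ∑[ p < M ] ∑[ q < N ] c * f p q
∑<-∑<-distribˡ-* M N c f =
  trans (∑<-distribˡ-* M c _) (∑<-cong M (λ {p} _ → ∑<-distribˡ-* N c (f p)))

∑<-*-∑< : ∀ M N (f g : ℕ → ℕ) → ∑< M f * ∑< N g ≡ ∑[ p < M ] ∑[ q < N ] f p * g q
∑<-*-∑< M N f g = begin
  ∑< M f * ∑< N g                  ≡⟨ *-comm (∑< M f) _ ⟩
  ∑< N g * ∑< M f                  ≡⟨ ∑<-distribˡ-* M (∑< N g) f ⟩
  ∑[ p < M ] ∑< N g * f p           ≡⟨ ∑<-cong M (λ {p} _ → *-comm (∑< N g) (f p)) ⟩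
  ∑[ p < M ] f p * ∑< N g           ≡⟨ ∑<-cong M (λ {p} _ → ∑<-distribˡ-* N (f p) g) ⟩
  ∑[ p < M ] ∑[ q < N ] f p * g q   ∎
  where open ≡-Reasoning

∑<-suc : ∀ N (f : ℕ → ℕ) → ∑< (suc N) f ≡ f 0 + ∑[ i < N ] f (suc i)
∑<-suc zero    f = +-comm 0 (f 0)
∑<-suc (suc N) f = trans (cong (_+ f (suc N)) (∑<-suc N f)) (+-assoc (f 0) _ _)

∑<-triangle : ∀ N (h : ℕ → ℕ → ℕ) →
  ∑[ r < N ] ∑[ p < suc r ] h p (r ∸ p) ≡ ∑[ p < N ] ∑< (N ∸ p) (h p)
∑<-triangle zero    h = refl
∑<-triangle (suc N) h = begin
    (∑[ r < N ] ∑[ p < suc r ] h p (r ∸ p)) + (∑[ p < suc N ] h p (N ∸ p))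
  ≡⟨ cong₂ _+_ (∑<-triangle N h) (cong (λ m → (∑[ p < N ] h p (N ∸ p)) + h N m) (n∸n≡0 N)) ⟩
    (∑[ p < N ] ∑< (N ∸ p) (h p)) + ((∑[ p < N ] h p (N ∸ p)) + h N 0)
  ≡⟨ sym (+-assoc (∑[ p < N ] ∑< (N ∸ p) (h p)) _ _) ⟩
    (∑[ p < N ] ∑< (N ∸ p) (h p)) + (∑[ p < N ] h p (N ∸ p)) + h N 0
  ≡⟨ cong₂ _+_ (sym (∑<-distrib-+ N _ _)) (cong (λ m → ∑< m (h N)) (sym (m+n∸n≡m 1 N))) ⟩
    (∑[ p < N ] (∑< (N ∸ p) (h p) + h p (N ∸ p))) + ∑< (suc N ∸ N) (h N)
  ≡⟨ cong (_+ ∑< (suc N ∸ N) (h N))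
       (∑<-cong N (λ {p} p<N → cong (λ m → ∑< m (h p)) (sym (+-∸-assoc 1 (<⇒≤ p<N))))) ⟩
    (∑[ p < N ] ∑< (suc N ∸ p) (h p)) + ∑< (suc N ∸ N) (h N)
  ∎
  where open ≡-Reasoning

square≤triangle : ∀ M K (h : ℕ → ℕ → ℕ) →
  ∑[ p < suc M ] ∑[ q < suc K ] h p q ≤ ∑[ r < suc (M + K) ] ∑[ p < suc r ] h p (r ∸ p)
square≤triangle M K h = begin
  ∑[ p < suc M ] ∑< (suc K) (h p)
    ≤⟨ ∑<-mono-≤ (suc M) (λ p≤M → ∑<-monoˡ-≤ (h _) (≤⇒≤′ (K<N∸p p≤M))) ⟩
  ∑[ p < suc M ] ∑< (suc N ∸ p) (h p)
    ≤⟨ ∑<-monoˡ-≤ (λ p → ∑< (suc N ∸ p) (h p)) (≤⇒≤′ (s≤s (m≤m+n M K))) ⟩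
  ∑[ p < suc N ] ∑< (suc N ∸ p) (h p)     ≡⟨ sym (∑<-triangle (suc N) h) ⟩
  ∑[ r < suc N ] ∑[ p < suc r ] h p (r ∸ p) ∎
  where
  open ≤-Reasoning
  N = M + K
  K<N∸p : ∀ {p} → p < suc M → suc K ≤ suc N ∸ p
  K<N∸p {p} (s≤s p≤M) = begin
    suc K              ≤⟨ s≤s (m≤n+m K (M ∸ p)) ⟩
    suc (M ∸ p + K)    ≡⟨ cong suc (sym (+-∸-comm K p≤M)) ⟩
    suc (N ∸ p)        ≡⟨ sym (+-∸-assoc 1 (≤-trans p≤M (m≤m+n M K))) ⟩
    suc N ∸ p          ∎

sumᶠ-toℕ : ∀ N (f : ℕ → ℕ) → sumᶠ {N} (λ k → f (toℕ k)) ≡ ∑< N f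
sumᶠ-toℕ zero    f = refl
sumᶠ-toℕ (suc N) f = trans (cong (f 0 +_) (sumᶠ-toℕ N (f ∘ suc))) (sym (∑<-suc N f))

^ᴿ≡^ : ∀ x n → x ^ᴿ n ≡ x ^ n
^ᴿ≡^ x zero    = refl
^ᴿ≡^ x (suc n) = cong (x *_) (^ᴿ≡^ x n)

×ᴿ≡* : ∀ m x → m ×ᴿ x ≡ m * x
×ᴿ≡* zero    x = refl
×ᴿ≡* (suc m) x = cong (x +_) (×ᴿ≡* m x)

binomial : ∀ a b r → (a + b) ^ r ≡ ∑[ p < suc r ] (r C p) * (a ^ p * b ^ (r ∸ p))
binomial a b r = begin
  (a + b) ^ r                                           ≡⟨ sym (^ᴿ≡^ (a + b) r) ⟩
  (a + b) ^ᴿ r                                          ≡⟨ Binomial.theorem r a b ⟩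
  sumᶠ {suc r} (λ k → term (toℕ k))                      ≡⟨ sumᶠ-toℕ (suc r) term ⟩
  ∑[ p < suc r ] term p                                 ≡⟨ ∑<-cong (suc r) (λ {p} _ → term≡ p) ⟩
  ∑[ p < suc r ] (r C p) * (a ^ p * b ^ (r ∸ p))          ∎
  where
  open ≡-Reasoning
  term : ℕ → ℕ
  term p = (r C p) ×ᴿ (a ^ᴿ p * b ^ᴿ (r ∸ p))
  term≡ : ∀ p → term p ≡ (r C p) * (a ^ p * b ^ (r ∸ p))
  term≡ p = trans (×ᴿ≡* (r C p) _) (cong₂ (λ x y → (r C p) * (x * y)) (^ᴿ≡^ a p) (^ᴿ≡^ b (r ∸ p)))

infixl 7.5 _!/_
_!/_ : ℕ → ℕ → ℕ
m !/ p = (m ! / p !) {{p !≢0}}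

m!/p*p!≡m! : ∀ {p m} → p ≤ m → m !/ p * p ! ≡ m !
m!/p*p!≡m! {p} p≤m = m/n*n≡m {{p !≢0}} (m≤n⇒m!∣n! p≤m)

[p+q]Cp*[p!*q!]≡[p+q]! : ∀ p q → ((p + q) C p) * (p ! * q !) ≡ (p + q) !
[p+q]Cp*[p!*q!]≡[p+q]! p q = begin
  ((p + q) C p) * (p ! * q !)             ≡⟨ cong (λ m → ((p + q) C p) * (p ! * m !)) (sym (m+n∸m≡n p q)) ⟩
  ((p + q) C p) * (p ! * (p + q ∸ p) !)   ≡⟨ nCk*[k!*[n∸k]!]≡n! (m≤m+n p q) ⟩
  (p + q) !                               ∎
  where
  open ≡-Reasoning
  nCk*[k!*[n∸k]!]≡n! : ∀ {n k} → k ≤ n → (n C k) * (k ! * (n ∸ k) !) ≡ n !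
  nCk*[k!*[n∸k]!]≡n! {n} {k} k≤n = trans (cong (_* (k ! * (n ∸ k) !)) (nCk≡n!/k![n-k]! k≤n))
    (m/n*n≡m {{k !* (n ∸ k) !≢0}} (k![n∸k]!∣n! k≤n))

[1+K]!/p≡[1+K]*K!/p : ∀ {p K} → p ≤ K → suc K !/ p ≡ suc K * K !/ p
[1+K]!/p≡[1+K]*K!/p {p} {K} p≤K = *-/-assoc (suc K) {{p !≢0}} (m≤n⇒m!∣n! p≤K)

n!/n≡1 : ∀ n → n !/ n ≡ 1
n!/n≡1 n = n/n≡1 (n !) {{n !≢0}}

expNum-closed : ∀ a K → expNum a K ≡ ∑[ p < suc K ] K !/ p * a ^ p
expNum-closed a zero    = refl
expNum-closed a (suc K) = begin
  suc K * expNum a K + a ^ suc K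
    ≡⟨ cong (λ s → suc K * s + a ^ suc K) (expNum-closed a K) ⟩
  suc K * (∑[ p < suc K ] K !/ p * a ^ p) + a ^ suc K
    ≡⟨ cong (_+ a ^ suc K) (∑<-distribˡ-* (suc K) (suc K) _) ⟩
  (∑[ p < suc K ] suc K * (K !/ p * a ^ p)) + a ^ suc K
    ≡⟨ cong₂ _+_ (∑<-cong (suc K) term) (sym (trans (cong (_* a ^ suc K) (n!/n≡1 (suc K))) (*-identityˡ _))) ⟩
  (∑[ p < suc K ] suc K !/ p * a ^ p) + suc K !/ suc K * a ^ suc K
    ∎
  where
  open ≡-Reasoning
  term : ∀ {p} → p < suc K → suc K * (K !/ p * a ^ p) ≡ suc K !/ p * a ^ p
  term {p} (s≤s p≤K) = trans (sym (*-assoc (suc K) (K !/ p) (a ^ p))) (cong (_* a ^ p) (sym ([1+K]!/p≡[1+K]*K!/p p≤K)))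

!/-convolution : ∀ {M K N p q} → p ≤ M → q ≤ K → p + q ≤ N →
  N ! * (M !/ p * K !/ q) ≡ M ! * K ! * (N !/ (p + q) * ((p + q) C p))
!/-convolution {M} {K} {N} {p} {q} p≤M q≤K p+q≤N =
  *-cancelʳ-≡ _ _ (p ! * q !) {{p !* q !≢0}} (begin
    N ! * (M !/ p * K !/ q) * (p ! * q !)
      ≡⟨ solve 5 (λ n x y u v → n :* (x :* y) :* (u :* v) := n :* ((x :* u) :* (y :* v)))
           refl (N !) (M !/ p) (K !/ q) (p !) (q !) ⟩
    N ! * (M !/ p * p ! * (K !/ q * q !))
      ≡⟨ cong₂ (λ x y → N ! * (x * y)) (m!/p*p!≡m! p≤M) (m!/p*p!≡m! q≤K) ⟩
    N ! * (M ! * K !)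
      ≡⟨ *-comm (N !) _ ⟩
    M ! * K ! * N !
      ≡⟨ cong (M ! * K ! *_) (sym (m!/p*p!≡m! p+q≤N)) ⟩
    M ! * K ! * (N !/ (p + q) * (p + q) !)
      ≡⟨ cong (λ x → M ! * K ! * (N !/ (p + q) * x)) (sym ([p+q]Cp*[p!*q!]≡[p+q]! p q)) ⟩
    M ! * K ! * (N !/ (p + q) * (((p + q) C p) * (p ! * q !)))
      ≡⟨ solve 4 (λ m w c f → m :* (w :* (c :* f)) := m :* (w :* c) :* f)
           refl (M ! * K !) (N !/ (p + q)) ((p + q) C p) (p ! * q !) ⟩
    M ! * K ! * (N !/ (p + q) * ((p + q) C p)) * (p ! * q !)
      ∎)
  where open ≡-Reasoning

expNum-cauchy : ∀ a b M K →
  (M + K) ! * (expNum a M * expNum b K) ≤ M ! * K ! * expNum (a + b) (M + K)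
expNum-cauchy a b M K = begin
  N ! * (expNum a M * expNum b K)
    ≡⟨ cong₂ (λ x y → N ! * (x * y)) (expNum-closed a M) (expNum-closed b K) ⟩
  N ! * ((∑[ p < suc M ] M !/ p * a ^ p) * (∑[ q < suc K ] K !/ q * b ^ q))
    ≡⟨ cong (N ! *_) (∑<-*-∑< (suc M) (suc K) _ _) ⟩
  N ! * (∑[ p < suc M ] ∑[ q < suc K ] M !/ p * a ^ p * (K !/ q * b ^ q))
    ≡⟨ ∑<-∑<-distribˡ-* (suc M) (suc K) (N !) _ ⟩
  ∑[ p < suc M ] ∑[ q < suc K ] N ! * (M !/ p * a ^ p * (K !/ q * b ^ q))
    ≡⟨ ∑<-cong (suc M) (λ p≤M → ∑<-cong (suc K) (λ q≤K → term (≤-pred p≤M) (≤-pred q≤K))) ⟩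
  ∑[ p < suc M ] ∑[ q < suc K ] M ! * K ! * h p q
    ≡⟨ sym (∑<-∑<-distribˡ-* (suc M) (suc K) (M ! * K !) h) ⟩
  M ! * K ! * (∑[ p < suc M ] ∑[ q < suc K ] h p q)
    ≤⟨ *-monoʳ-≤ (M ! * K !) (square≤triangle M K h) ⟩
  M ! * K ! * (∑[ r < suc N ] ∑[ p < suc r ] h p (r ∸ p))
    ≡⟨ cong (M ! * K ! *_) (∑<-cong (suc N) (λ {r} _ → diagonal r)) ⟩
  M ! * K ! * (∑[ r < suc N ] N !/ r * (a + b) ^ r)
    ≡⟨ cong (M ! * K ! *_) (sym (expNum-closed (a + b) N)) ⟩
  M ! * K ! * expNum (a + b) N
    ∎
  where
  open ≤-Reasoning
  N = M + K
  h : ℕ → ℕ → ℕ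
  h p q = N !/ (p + q) * ((p + q) C p) * (a ^ p * b ^ q)
  term : ∀ {p q} → p ≤ M → q ≤ K → N ! * (M !/ p * a ^ p * (K !/ q * b ^ q)) ≡ M ! * K ! * h p q
  term {p} {q} p≤M q≤K = begin-equality
    N ! * (M !/ p * a ^ p * (K !/ q * b ^ q))
      ≡⟨ solve 5 (λ n x u y v → n :* (x :* u :* (y :* v)) := n :* (x :* y) :* (u :* v))
           refl (N !) (M !/ p) (a ^ p) (K !/ q) (b ^ q) ⟩
    N ! * (M !/ p * K !/ q) * (a ^ p * b ^ q)
      ≡⟨ cong (_* (a ^ p * b ^ q)) (!/-convolution p≤M q≤K (+-mono-≤ p≤M q≤K)) ⟩
    M ! * K ! * (N !/ (p + q) * ((p + q) C p)) * (a ^ p * b ^ q)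
      ≡⟨ *-assoc (M ! * K !) _ _ ⟩
    M ! * K ! * h p q
      ∎
  diagonal : ∀ r → ∑[ p < suc r ] h p (r ∸ p) ≡ N !/ r * (a + b) ^ r
  diagonal r = begin-equality
    ∑[ p < suc r ] h p (r ∸ p)
      ≡⟨ ∑<-cong (suc r) (λ {p} p≤r →
           cong (λ s → N !/ s * (s C p) * (a ^ p * b ^ (r ∸ p))) (m+[n∸m]≡n (≤-pred p≤r))) ⟩
    ∑[ p < suc r ] N !/ r * (r C p) * (a ^ p * b ^ (r ∸ p))
      ≡⟨ ∑<-cong (suc r) (λ {p} _ → *-assoc (N !/ r) (r C p) _) ⟩
    ∑[ p < suc r ] N !/ r * ((r C p) * (a ^ p * b ^ (r ∸ p)))
      ≡⟨ sym (∑<-distribˡ-* (suc r) (N !/ r) _) ⟩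
    N !/ r * (∑[ p < suc r ] (r C p) * (a ^ p * b ^ (r ∸ p)))
      ≡⟨ cong (N !/ r *_) (sym (binomial a b r)) ⟩
    N !/ r * (a + b) ^ r
      ∎

*-<exp : ∀ {x y a b} → x <exp a → y <exp b → (x * y) <exp (a + b)
*-<exp {x} {y} {a} {b} (M , x<) (K , y<) = M + K , *-cancelˡ-< (M ! * K !) _ _ (begin-strict
  M ! * K ! * (x * y * (M + K) !)
    ≡⟨ solve 5 (λ m k x y n → m :* k :* (x :* y :* n) := n :* (x :* m :* (y :* k)))
         refl (M !) (K !) x y ((M + K) !) ⟩
  (M + K) ! * (x * M ! * (y * K !))      <⟨ *-monoʳ-< ((M + K) !) {{(M + K) !≢0}} (*-mono-< x< y<) ⟩
  (M + K) ! * (expNum a M * expNum b K)  ≤⟨ expNum-cauchy a b M K ⟩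
  M ! * K ! * expNum (a + b) (M + K)     ∎)
  where open ≤-Reasoning

<exp-monoˡ : ∀ {x y a} → x ≤ y → y <exp a → x <exp a
<exp-monoˡ x≤y (K , y<) = K , ≤-<-trans (*-monoˡ-≤ _ x≤y) y<

<exp⇒≤exp : ∀ {x a} → x <exp a → x ≤exp a
<exp⇒≤exp (K , x<) j = K , <-≤-trans (*-monoˡ-< (suc j) x<) (m≤m+n _ _)

1≤exp : ∀ a → 1 ≤exp a
1≤exp a j = 0 , m<m+n (1 * suc j) z<s

module _ {n} {G : Graph n} where
  open Graph G

  snoc : ∀ {x y z k} → Walk G x y k → Adj y z → Walk G x z (suc k)
  snoc nil        y~z = cons y~z nil
  snoc (cons a w) y~z = cons a (snoc w y~z)

  reverse : ∀ {x y k} → Walk G x y k → Walk G y x k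
  reverse nil        = nil
  reverse (cons a w) = snoc (reverse w) (Graph.sym G a)

module _ {n} (G : Graph n) where

  DistanceFunction : Set
  DistanceFunction = Σ (Fin n → Fin n → ℕ) λ d → ∀ x y → Dist G x y (d x y)

  private open RawMonad (¬¬-Monad {a = 0ℓ}) using (pure; _>>=_; rawApplicative)

  shortest-walk : ∀ {x y} k → Walk G x y k → ¬ ¬ ∃ (Dist G x y)
  shortest-walk {x} {y} = <-rec (λ k → Walk G x y k → ¬ ¬ ∃ (Dist G x y)) shorten
    where
    shorten : ∀ k → (∀ {m} → m < k → Walk G x y m → ¬ ¬ ∃ (Dist G x y)) → Walk G x y k → ¬ ¬ ∃ (Dist G x y)
    shorten k shorter w = ¬¬-excluded-middle {A = ∃ λ m → m < k × Walk G x y m} >>= λ where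
      (yes (m , m<k , w′)) → shorter m<k w′
      (no none)           → pure (k , w , λ m w′ → ≮⇒≥ (λ m<k → none (m , m<k , w′)))

  distanceFunction : Connected G → ¬ ¬ DistanceFunction
  distanceFunction connected = do
    dist ← sequence rawApplicative λ x → sequence rawApplicative λ y →
             shortest-walk _ (proj₂ (connected x y))
    pure ((λ x y → proj₁ (dist x y)) , (λ x y → proj₂ (dist x y)))

module Metric {n} {G : Graph n} (dist : DistanceFunction G) where
  open Graph G renaming (sym to adj-sym)

  d : Fin n → Fin n → ℕ
  d = proj₁ dist

  d-walk : ∀ x y → Walk G x y (d x y)
  d-walk x y = proj₁ (proj₂ dist x y)

  d-minimal : ∀ {x y k} → Walk G x y k → d x y ≤ k
  d-minimal {x} {y} {k} = proj₂ (proj₂ dist x y) k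

  Dist⇒≡d : ∀ {x y k} → Dist G x y k → k ≡ d x y
  Dist⇒≡d (w , minimal) = ≤-antisym (minimal _ (d-walk _ _)) (d-minimal w)

  d-sym : ∀ x y → d x y ≡ d y x
  d-sym x y = ≤-antisym (d-minimal (reverse (d-walk y x))) (d-minimal (reverse (d-walk x y)))

  d-stepʳ : ∀ {x y z} → Adj y z → d x z ≤ suc (d x y)
  d-stepʳ y~z = d-minimal (snoc (d-walk _ _) y~z)

  d-stepˡ : ∀ {x y z} → Adj y z → d z x ≤ suc (d y x)
  d-stepˡ y~z = d-minimal (cons (adj-sym y~z) (d-walk _ _))

  d≡0⇒≡ : ∀ {x y} → d x y ≡ 0 → x ≡ y
  d≡0⇒≡ {x} {y} eq with d-walk x y
  ... | w rewrite eq with w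
  ...   | nil = refl

  d-refl : ∀ x → d x x ≡ 0
  d-refl x = n≤0⇒n≡0 (d-minimal nil)

  d≡suc⇒≢ : ∀ {x y k} → d x y ≡ suc k → x ≢ y
  d≡suc⇒≢ {x} eq refl = 0≢1+n (trans (sym (d-refl x)) eq)

  d-adj : ∀ {x y} → Adj x y → d x y ≡ 1
  d-adj {x} {y} x~y = ≤-antisym (d-minimal (cons x~y nil)) (n≢0⇒n>0 (λ eq → irrefl (subst (Adj x) (sym (d≡0⇒≡ eq)) x~y)))

  d-two : ∀ {x y z} → Adj x y → Adj y z → x ≢ z → ¬ Adj x z → d x z ≡ 2
  d-two {x} {y} {z} x~y y~z x≢z x≁z = ≤-antisym upper lower
    where
    upper : d x z ≤ 2
    upper = d-minimal (cons x~y (cons y~z nil))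
    lower : 2 ≤ d x z
    lower with d x z in eq | d-walk x z
    ... | zero        | _               = ⊥-elim (x≢z (d≡0⇒≡ eq))
    ... | suc zero    | cons x~w nil    = ⊥-elim (x≁z x~w)
    ... | suc (suc _) | _               = s≤s (s≤s z≤n)

module MedianGeometry {n} {G : Graph n} (median : Median G) (dist : DistanceFunction G) where
  open Graph G renaming (sym to adj-sym)
  open Metric dist

  IsMedian : Fin n → Fin n → Fin n → Fin n → Set
  IsMedian x y z m = d x m + d m y ≡ d x y × d y m + d m z ≡ d y z × d z m + d m x ≡ d z x

  interval⇒ : ∀ {x y m} → InInterval G x y m → d x m + d m y ≡ d x y
  interval⇒ {x} {y} {m} I = I _ _ _ (proj₂ dist x m) (proj₂ dist m y) (proj₂ dist x y)

  ⇒interval : ∀ {x y m} → d x m + d m y ≡ d x y → InInterval G x y m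
  ⇒interval eq a b c xm my xy rewrite Dist⇒≡d xm | Dist⇒≡d my | Dist⇒≡d xy = eq

  median-exists : ∀ {x y z} → x ≢ y → y ≢ z → x ≢ z → ∃ (IsMedian x y z)
  median-exists x≢y y≢z x≢z with median _ _ _ x≢y y≢z x≢z
  ... | m , (I₁ , I₂ , I₃) , _ = m , interval⇒ I₁ , interval⇒ I₂ , interval⇒ I₃

  median-unique : ∀ {x y z m m′} → x ≢ y → y ≢ z → x ≢ z →
    IsMedian x y z m → IsMedian x y z m′ → m ≡ m′
  median-unique x≢y y≢z x≢z (e₁ , e₂ , e₃) (e₁′ , e₂′ , e₃′) with median _ _ _ x≢y y≢z x≢z
  ... | _ , _ , unique = trans (unique _ (⇒interval e₁) (⇒interval e₂) (⇒interval e₃))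
                           (sym (unique _ (⇒interval e₁′) (⇒interval e₂′) (⇒interval e₃′)))

  private
    m+n≡1⇒ : ∀ m n → m + n ≡ 1 → m ≡ 0 ⊎ n ≡ 0
    m+n≡1⇒ zero    n _  = inj₁ refl
    m+n≡1⇒ (suc m) n eq = inj₂ (m+n≡0⇒n≡0 m (suc-injective eq))

    adj⇒≢ : ∀ {x y} → Adj x y → x ≢ y
    adj⇒≢ x~y refl = irrefl x~y

  median-on-edge : ∀ {u v x m} → Adj u v → IsMedian u v x m → u ≡ m ⊎ v ≡ m
  median-on-edge u~v (uv , _) with m+n≡1⇒ _ _ (trans uv (d-adj u~v))
  ... | inj₁ um≡0 = inj₁ (d≡0⇒≡ um≡0)
  ... | inj₂ mv≡0 = inj₂ (sym (d≡0⇒≡ mv≡0))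

  edge-distances : ∀ {u v} → Adj u v → ∀ x → d x v ≡ suc (d x u) ⊎ d x u ≡ suc (d x v)
  edge-distances {u} {v} u~v x with x ≟ᶠ u | x ≟ᶠ v
  ... | yes refl | _        = inj₁ (trans (d-adj u~v) (cong suc (sym (d-refl x))))
  ... | no _     | yes refl = inj₂ (trans (d-adj (adj-sym u~v)) (cong suc (sym (d-refl x))))
  ... | no x≢u   | no x≢v
    with median-exists {u} {v} {x} (adj⇒≢ u~v) (x≢v ∘ sym) (x≢u ∘ sym)
  ... | m , isMedian@(_ , vx , xu) with median-on-edge u~v isMedian
  ...   | inj₁ refl = inj₁ (begin
    d x v         ≡⟨ d-sym x v ⟩
    d v x         ≡⟨ sym vx ⟩
    d v u + d u x ≡⟨ cong₂ _+_ (d-adj (adj-sym u~v)) (d-sym u x) ⟩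
    suc (d x u)   ∎)
    where open ≡-Reasoning
  ...   | inj₂ refl = inj₂ (begin
    d x u         ≡⟨ sym xu ⟩
    d x v + d v u ≡⟨ cong (d x v +_) (d-adj (adj-sym u~v)) ⟩
    d x v + 1     ≡⟨ +-comm (d x v) 1 ⟩
    suc (d x v)   ∎)
    where open ≡-Reasoning

  edge-ends-not-equidistant : ∀ {u v} → Adj u v → ∀ x → d x u ≢ d x v
  edge-ends-not-equidistant u~v x du≡dv with edge-distances u~v x
  ... | inj₁ dv≡1+du = 1+n≢n (trans (sym dv≡1+du) (sym du≡dv))
  ... | inj₂ du≡1+dv = 1+n≢n (trans (sym du≡1+dv) du≡dv)

  W : Fin n → Fin n → Fin n → Set
  W u v x = d x u < d x v

  W-split : ∀ {u v} → Adj u v → ∀ x → W u v x ⊎ W v u x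
  W-split u~v x = Sum.map (≤-reflexive ∘ sym) (≤-reflexive ∘ sym) (edge-distances u~v x)

  W-suc : ∀ {u v x} → Adj u v → W u v x → d x v ≡ suc (d x u)
  W-suc u~v x∈W = ≤-antisym (d-stepʳ u~v) x∈W

  W-disjoint : ∀ {u v x} → W u v x → ¬ W v u x
  W-disjoint = <-asym

  crossing-distances : ∀ {u v a b} → Adj u v → Adj a b → W u v a → W v u b →
    d b v ≡ d a u × d b u ≡ suc (d a u)
  crossing-distances {u} {v} {a} {b} u~v a~b a∈W b∈W = bv≡au , trans bu≡1+bv (cong suc bv≡au)
    where
    bu≡1+bv : d b u ≡ suc (d b v)
    bu≡1+bv = W-suc (adj-sym u~v) b∈W
    bv≡au : d b v ≡ d a u
    bv≡au = ≤-antisym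
      (≤-pred (subst (_≤ suc (d a u)) bu≡1+bv (d-stepˡ a~b)))
      (≤-pred (subst (_≤ suc (d b v)) (W-suc u~v a∈W) (d-stepˡ (adj-sym a~b))))

  square-collapse : ∀ {p q r s z k} → Adj p r → Adj r q → Adj p s → Adj s q → p ≢ q →
    d z p ≡ suc k → d z q ≡ suc k → d z r ≡ k → d z s ≡ k → r ≡ s
  square-collapse {p} {q} {r} {s} {z} {k} p~r r~q p~s s~q p≢q zp zq zr zs =
    median-unique p≢q (d≡suc⇒≢ zq ∘ sym) (d≡suc⇒≢ zp ∘ sym)
      (common-neighbour-median p~r r~q zr) (common-neighbour-median p~s s~q zs)
    where
    pq≡2 : d p q ≡ 2
    pq≡2 = d-two p~r r~q p≢q (λ p~q → edge-ends-not-equidistant p~q z (trans zp (sym zq)))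
    common-neighbour-median : ∀ {t} → Adj p t → Adj t q → d z t ≡ k → IsMedian p q z t
    common-neighbour-median p~t t~q zt =
      trans (cong₂ _+_ (d-adj p~t) (d-adj t~q)) (sym pq≡2) ,
      trans (cong₂ _+_ (d-adj (adj-sym t~q)) (trans (d-sym _ z) zt)) (sym (trans (d-sym q z) zq)) ,
      trans (cong₂ _+_ zt (d-adj (adj-sym p~t))) (trans (+-comm k 1) (sym zp))

  -- If c ∈ W_vu, put k = d(a,u). Then d(e,u) = k would make a and e medians of b, c, u, and
  -- d(e,v) = k + 1 would make b and c medians of a, e, v; every other value of d(e,u), d(e,v)
  -- contradicts the edges at e.
  square-side : ∀ {u v a b c e} → Adj u v → Adj a b → Adj a c → Adj b e → Adj c e →
    a ≢ e → b ≢ c → W u v a → W v u b → W u v c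
  square-side {u} {v} {a} {b} {c} {e} u~v a~b a~c b~e c~e a≢e b≢c a∈W b∈W with W-split u~v c
  ... | inj₁ c∈W  = c∈W
  ... | inj₂ c∈W′ = ⊥-elim absurd
    where
    k = d a u
    flip : ∀ {x y m} → d x y ≡ m → d y x ≡ m
    flip {x} {y} = trans (d-sym y x)
    bv≡k  = proj₁ (crossing-distances u~v a~b a∈W b∈W)
    bu≡1+k = proj₂ (crossing-distances u~v a~b a∈W b∈W)
    cv≡k  = proj₁ (crossing-distances u~v a~c a∈W c∈W′)
    cu≡1+k = proj₂ (crossing-distances u~v a~c a∈W c∈W′)
    eu≢k : d e u ≢ k
    eu≢k eu≡k = a≢e (square-collapse (adj-sym a~b) a~c b~e (adj-sym c~e) b≢c
      (flip bu≡1+k) (flip cu≡1+k) (d-sym u a) (flip eu≡k))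
    ev≢1+k : d e v ≢ suc k
    ev≢1+k ev≡1+k = b≢c (square-collapse a~b b~e a~c c~e a≢e
      (flip (W-suc u~v a∈W)) (flip ev≡1+k) (flip bv≡k) (flip cv≡k))
    ev≢k : d e v ≢ k
    ev≢k ev≡k = edge-ends-not-equidistant b~e v (trans (flip bv≡k) (sym (flip ev≡k)))
    k<eu : k < d e u
    k<eu = ≤∧≢⇒< (≤-pred (subst (_≤ suc (d e u)) cu≡1+k (d-stepˡ (adj-sym c~e)))) (eu≢k ∘ sym)
    ev<k : d e v < k
    ev<k = ≤∧≢⇒< (≤-pred (≤∧≢⇒< (subst (d e v ≤_) (cong suc bv≡k) (d-stepˡ b~e)) ev≢1+k)) ev≢k
    absurd : ⊥
    absurd = <-irrefl refl (<-≤-trans k<eu (≤-trans (d-stepʳ (adj-sym u~v)) ev<k))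

  Crosses : Fin n → Fin n → Fin n × Fin n → Set
  Crosses u v e = W u v (proj₁ e) × W v u (proj₂ e)

  Θ₀-crosses : ∀ {u v f g} → Adj u v → Θ₀ G f g → Crosses u v g → Crosses u v f
  Θ₀-crosses u~v (a~b , c~e , a~c , b~e , a≢e , b≢c) (c∈W , e∈W) =
    square-side u~v c~e (adj-sym a~c) (adj-sym b~e) a~b (b≢c ∘ sym) (a≢e ∘ sym) c∈W e∈W ,
    square-side (adj-sym u~v) (adj-sym c~e) (adj-sym b~e) (adj-sym a~c) (adj-sym a~b) (a≢e ∘ sym) (b≢c ∘ sym) e∈W c∈W

  Θ-crosses : ∀ {u v f} → Adj u v → Θ G f (u , v) → Crosses u v f ⊎ Crosses v u f
  Θ-crosses {u} {v} u~v ε = inj₁ (W-self u~v , W-self (adj-sym u~v))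
    where
    W-self : ∀ {x y} → Adj x y → W x y x
    W-self {x} x~y = subst₂ _<_ (sym (d-refl x)) (sym (d-adj x~y)) z<s
  Θ-crosses u~v (inj₁ θ₀ ◅ θ) = Sum.map (Θ₀-crosses u~v θ₀) (Θ₀-crosses (adj-sym u~v) θ₀) (Θ-crosses u~v θ)
  Θ-crosses u~v (inj₂ (_ , refl) ◅ θ) = Sum.swap (Sum.map Prod.swap Prod.swap (Θ-crosses u~v θ))

  Θ-swap : ∀ {u v f} → Adj u v → Θ G f (u , v) → Θ G f (v , u)
  Θ-swap u~v θ = θ ◅◅ (inj₂ (u~v , refl) ◅ ε)

  Θ-not-within : ∀ {u v y z} → Adj u v → Θ G (y , z) (u , v) → W u v y → W u v z → ⊥
  Θ-not-within u~v θ y∈W z∈W with Θ-crosses u~v θ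
  ... | inj₁ (_ , z∈W′) = W-disjoint z∈W z∈W′
  ... | inj₂ (y∈W′ , _) = W-disjoint y∈W y∈W′

  W-geodesic : ∀ {e p q} → Adj p q → (∀ {y z} → Θ G (y , z) e → W p q y → W p q z → ⊥) →
    ∀ {x k} → Walk G x p k → k ≡ d x p → W p q x → Reach G e p x
  W-geodesic p~q within nil _ _ = here
  W-geodesic {p = p} {q} p~q within {x} (cons {w = w} {k = k} x~w walk) 1+k≡xp x∈W =
    step (W-geodesic p~q within walk k≡wp w∈W) (adj-sym x~w) (λ θ → within θ w∈W x∈W)
    where
    k≡wp : k ≡ d w p
    k≡wp = ≤-antisym (≤-pred (subst (_≤ suc (d w p)) (sym 1+k≡xp) (d-stepˡ (adj-sym x~w)))) (d-minimal walk)
    w∈W : W p q w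
    w∈W = subst (_< d w q) k≡wp (≤-pred (subst (_≤ suc (d w q))
      (trans (W-suc p~q x∈W) (cong suc (sym 1+k≡xp))) (d-stepˡ (adj-sym x~w))))

  halfspaces-cover : ∀ {u v} → Adj u v → ∀ x → Halfspace G (u , v) u x ⊎ Halfspace G (u , v) v x
  halfspaces-cover u~v x with W-split u~v x
  ... | inj₁ x∈W = inj₁ (W-geodesic u~v (Θ-not-within u~v) (d-walk x _) refl x∈W)
  ... | inj₂ x∈W = inj₂ (W-geodesic (adj-sym u~v) (Θ-not-within (adj-sym u~v) ∘ Θ-swap u~v) (d-walk x _) refl x∈W)

module _ {n} (G : Graph n) where

  minoritySet : ∀ {e y} → Majority G e y → Subset n
  minoritySet (inj₁ ((_ , (S , _) , _) , _)) = S
  minoritySet (inj₂ ((_ , (S , _) , _) , _)) = S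

  minoritySet-small : ∀ {e y} (m : Majority G e y) → SmallForN n ∣ minoritySet m ∣
  minoritySet-small (inj₁ ((_ , (_ , ∣S∣≡k , _) , small) , _)) = subst (SmallForN n) (sym ∣S∣≡k) small
  minoritySet-small (inj₂ ((_ , (_ , ∣S∣≡k , _) , small) , _)) = subst (SmallForN n) (sym ∣S∣≡k) small

  ∉minoritySet⇒Majority : ∀ {u v y x} → (∀ x → Halfspace G (u , v) u x ⊎ Halfspace G (u , v) v x) →
    (m : Majority G (u , v) y) → x ∉ minoritySet m → Majority G (u , v) x
  ∉minoritySet⇒Majority {x = x} cover (inj₁ (minority@(_ , (_ , _ , S↔H) , _) , _)) x∉S with cover x
  ... | inj₁ x∈Hu = inj₁ (minority , x∈Hu)
  ... | inj₂ x∈Hv = contradiction (proj₂ (S↔H x) x∈Hv) x∉S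
  ∉minoritySet⇒Majority {x = x} cover (inj₂ (minority@(_ , (_ , _ , S↔H) , _) , _)) x∉S with cover x
  ... | inj₁ x∈Hu = contradiction (proj₂ (S↔H x) x∈Hu) x∉S
  ... | inj₂ x∈Hv = inj₂ (minority , x∈Hv)

∣p∪q∣≤∣p∣+∣q∣ : ∀ {n} (p q : Subset n) → ∣ p ∪ q ∣ ≤ ∣ p ∣ + ∣ q ∣
∣p∪q∣≤∣p∣+∣q∣ []            []            = z≤n
∣p∪q∣≤∣p∣+∣q∣ (inside  ∷ p) (inside  ∷ q) = s≤s (≤-trans (∣p∪q∣≤∣p∣+∣q∣ p q) (+-monoʳ-≤ ∣ p ∣ (n≤1+n _)))
∣p∪q∣≤∣p∣+∣q∣ (inside  ∷ p) (outside ∷ q) = s≤s (∣p∪q∣≤∣p∣+∣q∣ p q)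
∣p∪q∣≤∣p∣+∣q∣ (outside ∷ p) (inside  ∷ q) =
  subst (suc ∣ p ∪ q ∣ ≤_) (sym (+-suc ∣ p ∣ ∣ q ∣)) (s≤s (∣p∪q∣≤∣p∣+∣q∣ p q))
∣p∪q∣≤∣p∣+∣q∣ (outside ∷ p) (outside ∷ q) = ∣p∪q∣≤∣p∣+∣q∣ p q

b^[2∣p∪q∣]≤b^[2∣p∣]*b^[2∣q∣] : ∀ {n} b .{{_ : NonZero b}} (p q : Subset n) →
  b ^ (2 * ∣ p ∪ q ∣) ≤ b ^ (2 * ∣ p ∣) * b ^ (2 * ∣ q ∣)
b^[2∣p∪q∣]≤b^[2∣p∣]*b^[2∣q∣] b p q = begin
  b ^ (2 * ∣ p ∪ q ∣)               ≤⟨ ^-monoʳ-≤ b (*-monoʳ-≤ 2 (∣p∪q∣≤∣p∣+∣q∣ p q)) ⟩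
  b ^ (2 * (∣ p ∣ + ∣ q ∣))          ≡⟨ cong (b ^_) (*-distribˡ-+ 2 ∣ p ∣ ∣ q ∣) ⟩
  b ^ (2 * ∣ p ∣ + 2 * ∣ q ∣)        ≡⟨ ^-distribˡ-+-* b (2 * ∣ p ∣) (2 * ∣ q ∣) ⟩
  b ^ (2 * ∣ p ∣) * b ^ (2 * ∣ q ∣)  ∎
  where open ≤-Reasoning

complement-card-≤ : ∀ {n k} {P : Fin n → Set} (U : Subset n) → Card P k → (∀ x → x ∉ U → P x) → n ∸ k ≤ ∣ U ∣
complement-card-≤ {n} {k} U (s , ∣s∣≡k , s↔P) P-outside = begin
  n ∸ k       ≡⟨ cong (n ∸_) (sym ∣s∣≡k) ⟩
  n ∸ ∣ s ∣   ≡⟨ sym (∣∁p∣≡n∸∣p∣ s) ⟩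
  ∣ ∁ s ∣     ≤⟨ p⊆q⇒∣p∣≤∣q∣ ∁s⊆U ⟩
  ∣ U ∣       ∎
  where
  open ≤-Reasoning
  ∁s⊆U : ∁ s ⊆ U
  ∁s⊆U {x} x∈∁s with x ∈? U
  ... | yes x∈U = x∈U
  ... | no  x∉U = contradiction (proj₂ (s↔P x) (P-outside x x∉U)) (x∈∁p⇒x∉p x∈∁s)

module _ {ℓ n} (S : Fin ℓ → Subset n) where

  unionBelow : ∀ i → i ≤ ℓ → Subset n
  unionBelow zero    _   = ∅
  unionBelow (suc i) i<ℓ = S (fromℕ< i<ℓ) ∪ unionBelow i (<⇒≤ i<ℓ)

  ∉unionBelow : ∀ i (i≤ℓ : i ≤ ℓ) {x j} → x ∉ unionBelow i i≤ℓ → toℕ j < i → x ∉ S j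
  ∉unionBelow (suc i) i<ℓ {x} x∉U j<1+i with m<1+n⇒m<n∨m≡n j<1+i
  ... | inj₁ j<i = ∉unionBelow i (<⇒≤ i<ℓ) (x∉U ∘ x∈p∪q⁺ ∘ inj₂) j<i
  ... | inj₂ j≡i =
    subst (λ j → x ∉ S j) (toℕ-injective (trans (toℕ-fromℕ< i<ℓ) (sym j≡i))) (x∉U ∘ x∈p∪q⁺ ∘ inj₁)

  module _ {a b} .{{_ : NonZero b}} (small : ∀ j → (b ^ (2 * ∣ S j ∣)) <exp a) where

    unionBelow-<exp : ∀ i (i<ℓ : suc i ≤ ℓ) → (b ^ (2 * ∣ unionBelow (suc i) i<ℓ ∣)) <exp (suc i * a)
    unionBelow-<exp zero    i<ℓ = subst₂ _<exp_
      (cong (λ s → b ^ (2 * ∣ s ∣)) (sym (∪-identityʳ S₀))) (sym (+-identityʳ a)) (small (fromℕ< i<ℓ))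
      where S₀ = S (fromℕ< i<ℓ)
    unionBelow-<exp (suc i) i<ℓ =
      <exp-monoˡ (b^[2∣p∪q∣]≤b^[2∣p∣]*b^[2∣q∣] b Sᵢ Uᵢ)
        (*-<exp {b ^ (2 * ∣ Sᵢ ∣)} {b ^ (2 * ∣ Uᵢ ∣)} (small _) (unionBelow-<exp i (<⇒≤ i<ℓ)))
      where
      Sᵢ = S (fromℕ< i<ℓ)
      Uᵢ = unionBelow (suc i) (<⇒≤ i<ℓ)

    unionBelow-≤exp : ∀ i (i≤ℓ : i ≤ ℓ) {m} → m ≤ ∣ unionBelow i i≤ℓ ∣ → (b ^ (2 * m)) ≤exp (i * a)
    unionBelow-≤exp zero    _   m≤∣⊥∣ rewrite n≤0⇒n≡0 (subst (_ ≤_) (∣⊥∣≡0 n) m≤∣⊥∣) = 1≤exp 0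
    unionBelow-≤exp (suc i) i<ℓ {m} m≤∣U∣ = <exp⇒≤exp {b ^ (2 * m)}
      (<exp-monoˡ {y = b ^ (2 * ∣ unionBelow (suc i) i<ℓ ∣)} (^-monoʳ-≤ b (*-monoʳ-≤ 2 m≤∣U∣))
        (unionBelow-<exp i i<ℓ))

lemma23 : (n : ℕ) → 3 ≤ n → (G : Graph n) → Connected G → Median G →
    (ω : Fin n → ℕ) →
    (∀ a b → Graph.Adj G a b → IsMinority G (a , b) a ⊎ IsMinority G (a , b) b) →
    (v₀ : Fin n) →
    (∀ a b → Graph.Adj G a b → Majority G (a , b) v₀) →
    (umax : Fin n) →
    (∀ u a b → Dist G v₀ u a → Dist G v₀ umax b → a + ω u ≤ b + ω umax) →
    (∀ b → Dist G v₀ umax b → ω v₀ < b + ω umax) →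
    umax ≢ v₀ →
    (ℓ : ℕ) → (w : Fin ℓ → Fin n) →
    (∀ j → Graph.Adj G v₀ (w j)) →
    (∀ j → ¬ Reach G (v₀ , w j) v₀ umax) →
    (∀ j j' → Θ G (v₀ , w j) (v₀ , w j') → j ≡ j') →
    (∀ c → Graph.Adj G v₀ c → ¬ Reach G (v₀ , c) v₀ umax →
       ∃[ j ] Θ G (v₀ , c) (v₀ , w j)) →
    (i : ℕ) → i ≤ ℓ → (k : ℕ) →
    Card (λ v → ∀ (j : Fin ℓ) → toℕ j < i → Majority G (v₀ , w j) v) k →
    (n ^ (2 * (n ∸ k))) ≤exp (i * n)
lemma23 n 3≤n G connected median _ _ v₀ v₀-majority _ _ _ _ ℓ w v₀~w _ _ _ i i≤ℓ k card =
  unionBelow-≤exp S {{n≢0}} (minoritySet-small G ∘ M) i i≤ℓ n∸k≤∣U∣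
  where
  n≢0 : NonZero n
  n≢0 = >-nonZero (≤-trans (s≤s z≤n) 3≤n)
  M : ∀ j → Majority G (v₀ , w j) v₀
  M j = v₀-majority v₀ (w j) (v₀~w j)
  S : Fin ℓ → Subset n
  S j = minoritySet G (M j)
  U = unionBelow S i i≤ℓ
  -- Distances exist only classically, but the inequality is decidable.
  n∸k≤∣U∣ : n ∸ k ≤ ∣ U ∣
  n∸k≤∣U∣ = decidable-stable (n ∸ k ≤? ∣ U ∣) (¬¬-map
    (λ dist → complement-card-≤ U card λ x x∉U j j<i →
      ∉minoritySet⇒Majority G (MedianGeometry.halfspaces-cover median dist (v₀~w j)) (M j)
        (∉unionBelow S i i≤ℓ x∉U j<i))
    (distanceFunction G connected))
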